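{- Let $C\subseteq\mathbb{F}_q^n$ be a constant weight linear code. Then the map from the set of subcodes of $C$ to $2^{\{1,\dots,n\}}$ sending a subcode $C'$ to $\mathrm{Supp}(C')$ is injective.
   Context: A subcode is a linear subspace of $C$. For a subcode $D$, $\mathrm{Supp}(D)=\{x\in\{1,\dots,n\}: \exists\, d\in D,\ d_x\neq0\}$. $C$ is of constant weight if all its nonzero codewords have the same number of nonzero coordinates. -}

module Defs where

open import Level using (Level; _⊔_; suc)
open import Data.Nat using (ℕ)
open import Data.Fin using (Fin)
open import Data.List using (length; filter)
open import Data.List.Base using (allFin)
open import Data.Product using (Σ; ∃; _×_; _,_)
open import Data.Vec.Functional using (Vector)
open import Function.Definitions using (Injective; Surjective)
open import Relation.Nullary using (¬_; ¬?)
open import Relation.Unary using (Pred; _⊆_)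
open import Relation.Binary.PropositionalEquality using (_≡_)
open import Algebra.Bundles using (CommutativeRing)

record FiniteField (c ℓ : Level) : Set (suc (c ⊔ ℓ)) where
  field
    commRing : CommutativeRing c ℓ
  open CommutativeRing commRing public
  field
    0≉1     : ¬ (0# ≈ 1#)
    inverse : ∀ x → ¬ (x ≈ 0#) → ∃ λ y → (x * y) ≈ 1#
    _≟_     : ∀ x y → Relation.Nullary.Dec (x ≈ y)
    q       : ℕ
    enum    : Fin q → Carrier
    enum-injective  : Injective _≡_ _≈_ enum
    enum-surjective : Surjective _≡_ _≈_ enum

module Codes {c ℓ : Level} (F : FiniteField c ℓ) where
  open FiniteField F

  Word : ℕ → Set c
  Word n = Vector Carrier n

  _≋_ : ∀ {n} → Word n → Word n → Set ℓ
  u ≋ v = ∀ i → u i ≈ v i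

  zeroW : ∀ {n} → Word n
  zeroW _ = 0#

  _⊕_ : ∀ {n} → Word n → Word n → Word n
  (u ⊕ v) i = u i + v i

  _·_ : ∀ {n} → Carrier → Word n → Word n
  (a · v) i = a * v i

  record IsSubspace {n : ℕ} {p : Level} (C : Pred (Word n) p) : Set (c ⊔ ℓ ⊔ p) where
    field
      respects : ∀ {u v} → u ≋ v → C u → C v
      has-zero : C zeroW
      closed-+ : ∀ {u v} → C u → C v → C (u ⊕ v)
      closed-· : ∀ a {v} → C v → C (a · v)

  weight : ∀ {n} → Word n → ℕ
  weight {n} v = length (filter (λ i → ¬? (v i ≟ 0#)) (allFin n))

  isNonzero : ∀ {n} → Word n → Set ℓ
  isNonzero v = ¬ (v ≋ zeroW)

  IsConstantWeight : ∀ {n p} → Pred (Word n) p → Set (c ⊔ ℓ ⊔ p)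
  IsConstantWeight C =
    ∀ {u v} → C u → C v → isNonzero u → isNonzero v → weight u ≡ weight v

  IsSubcode : ∀ {n p} → Pred (Word n) p → Pred (Word n) p → Set (c ⊔ ℓ ⊔ p)
  IsSubcode C D = IsSubspace D × (D ⊆ C)

  Supp : ∀ {n p} → Pred (Word n) p → Pred (Fin n) (c ⊔ ℓ ⊔ p)
  Supp D x = ∃ λ d → D d × ¬ (d x ≈ 0#)

module Submission where

-- Let u ∈ C be supported inside Supp D. Pick for every coordinate x in the support of u a
-- codeword d_x ∈ D with (d_x)_x ≠ 0; the combinations φ a = Σ a_x d_x (a ∈ F^n) lie in D and
-- the words ψ a = φ a − u lie in C. Counting nonzero entries coordinatewise gives
-- Σ_a wt (ψ a) = Σ_a wt (φ a): on the support of u the coordinate a ↦ (φ a)_x is a nonzero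
-- linear form, and translating it by a constant does not change how often it is nonzero.
-- If no ψ a vanished, each would have the common weight W of C, whereas wt (φ a) ≤ W and
-- φ 0 = 0; so some ψ a = 0, i.e. u = φ a ∈ D. Subcodes with equal supports thus contain
-- each other.

open import Defs
open import Level using (Level)

open import Data.Nat as ℕ using (ℕ; zero; suc; _≤_; _<_; z≤n)
open import Data.Nat.Properties
  using (+-0-commutativeMonoid; ≤-reflexive; ≤-trans; m≤m+n; +-mono-≤; +-mono-<-≤; +-mono-≤-<;
         +-cancelˡ-≡; <⇒≢; n≢0⇒n>0; n≤0⇒n≡0)
open import Data.Fin using (Fin; zero; suc; punchIn)
open import Data.Fin.Properties using (any?; all?; punchInᵢ≢i)
open import Data.Vec using (Vec; []; _∷_; replicate)
open import Data.List using (length; filter; tabulate)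
open import Data.Product using (Σ; ∃; _×_; _,_; proj₁; proj₂)
open import Function using (_∘_; id)
open import Relation.Nullary using (¬_; Dec; yes; no; ¬?; contradiction)
import Relation.Nullary.Decidable as Dec
open import Relation.Unary using (Pred; Decidable; _⊆_; _≐_)
open import Relation.Binary.PropositionalEquality as ≡ using (_≡_; _≗_; ≢-sym)
open import Algebra.Properties.CommutativeMonoid.Sum +-0-commutativeMonoid
  using (sum-syntax; sum-cong-≗; ∑-distrib-+; ∑-comm; sum-remove; sum-replicate-zero)

indicator : ∀ {a} {A : Set a} → Dec A → ℕ
indicator (yes _) = 1
indicator (no _)  = 0

indicator+indicator-¬?≡1 : ∀ {a} {A : Set a} (d : Dec A) → indicator d ℕ.+ indicator (¬? d) ≡ 1
indicator+indicator-¬?≡1 (yes _) = ≡.refl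
indicator+indicator-¬?≡1 (no _)  = ≡.refl

length-filter-tabulate : ∀ {a p k} {A : Set a} {P : Pred A p} (P? : Decidable P) (f : Fin k → A) →
  length (filter P? (tabulate f)) ≡ ∑[ i < k ] indicator (P? (f i))
length-filter-tabulate {k = zero}  P? f = ≡.refl
length-filter-tabulate {k = suc k} P? f with P? (f zero)
... | yes _ = ≡.cong suc (length-filter-tabulate P? (f ∘ suc))
... | no _  = length-filter-tabulate P? (f ∘ suc)

∑-const-1 : ∀ k → ∑[ i < k ] 1 ≡ k
∑-const-1 zero    = ≡.refl
∑-const-1 (suc k) = ≡.cong suc (∑-const-1 k)

∑-indicator-unique : ∀ {p k} {P : Pred (Fin k) p} (P? : Decidable P) {i₀ : Fin k} →
  P i₀ → (∀ {i} → P i → i ≡ i₀) → ∑[ i < k ] indicator (P? i) ≡ 1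
∑-indicator-unique {k = suc k} P? {i₀} Pi₀ unique = begin
  ∑[ i < suc k ] indicator (P? i)
    ≡⟨ sum-remove {i = i₀} (indicator ∘ P?) ⟩
  indicator (P? i₀) ℕ.+ ∑[ j < k ] indicator (P? (punchIn i₀ j))
    ≡⟨ ≡.cong₂ ℕ._+_ at-i₀ elsewhere ⟩
  1 ℕ.+ 0
    ∎
  where
  open ≡.≡-Reasoning
  at-i₀ : indicator (P? i₀) ≡ 1
  at-i₀ with P? i₀
  ... | yes _   = ≡.refl
  ... | no ¬Pi₀ = contradiction Pi₀ ¬Pi₀
  off-i₀ : ∀ j → indicator (P? (punchIn i₀ j)) ≡ 0
  off-i₀ j with P? (punchIn i₀ j)
  ... | yes Pj = contradiction (unique Pj) (punchInᵢ≢i i₀ j)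
  ... | no _   = ≡.refl
  elsewhere : ∑[ j < k ] indicator (P? (punchIn i₀ j)) ≡ 0
  elsewhere = ≡.trans (sum-cong-≗ off-i₀) (sum-replicate-zero k)

∑-mono-≤ : ∀ {k} {f g : Fin k → ℕ} → (∀ i → f i ≤ g i) → ∑[ i < k ] f i ≤ ∑[ i < k ] g i
∑-mono-≤ {zero}  f≤g = z≤n
∑-mono-≤ {suc k} f≤g = +-mono-≤ (f≤g zero) (∑-mono-≤ (f≤g ∘ suc))

∑-mono-< : ∀ {k} {f g : Fin k → ℕ} → (∀ i → f i ≤ g i) → ∀ i₀ → f i₀ < g i₀ →
  ∑[ i < k ] f i < ∑[ i < k ] g i
∑-mono-< {suc k} f≤g zero    f<g = +-mono-<-≤ f<g (∑-mono-≤ (f≤g ∘ suc))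
∑-mono-< {suc k} f≤g (suc i) f<g = +-mono-≤-< (f≤g zero) (∑-mono-< (f≤g ∘ suc) i f<g)

term≤∑ : ∀ {k} (f : Fin k → ℕ) i → f i ≤ ∑[ j < k ] f j
term≤∑ {suc k} f i = ≤-trans (m≤m+n (f i) _) (≤-reflexive (≡.sym (sum-remove {i = i} f)))

module CoefficientSums (s : ℕ) where

  ∑ᵛ : ∀ m → (Vec (Fin s) m → ℕ) → ℕ
  ∑ᵛ zero    f = f []
  ∑ᵛ (suc m) f = ∑[ i < s ] ∑ᵛ m (λ a → f (i ∷ a))

  ∑ᵛ-cong : ∀ m {f g : Vec (Fin s) m → ℕ} → f ≗ g → ∑ᵛ m f ≡ ∑ᵛ m g
  ∑ᵛ-cong zero    f≗g = f≗g []
  ∑ᵛ-cong (suc m) f≗g = sum-cong-≗ (λ i → ∑ᵛ-cong m (λ a → f≗g (i ∷ a)))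

  ∑ᵛ-∑-comm : ∀ m {k} (f : Vec (Fin s) m → Fin k → ℕ) →
    ∑ᵛ m (λ a → ∑[ j < k ] f a j) ≡ ∑[ j < k ] ∑ᵛ m (λ a → f a j)
  ∑ᵛ-∑-comm zero    f = ≡.refl
  ∑ᵛ-∑-comm (suc m) f =
    ≡.trans (sum-cong-≗ (λ i → ∑ᵛ-∑-comm m (λ a → f (i ∷ a))))
            (∑-comm (λ i j → ∑ᵛ m (λ a → f (i ∷ a) j)))

  ∑ᵛ-mono-≤ : ∀ m {f g : Vec (Fin s) m → ℕ} → (∀ a → f a ≤ g a) → ∑ᵛ m f ≤ ∑ᵛ m g
  ∑ᵛ-mono-≤ zero    f≤g = f≤g []
  ∑ᵛ-mono-≤ (suc m) f≤g = ∑-mono-≤ (λ i → ∑ᵛ-mono-≤ m (λ a → f≤g (i ∷ a)))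

  ∑ᵛ-mono-< : ∀ m {f g : Vec (Fin s) m → ℕ} → (∀ a → f a ≤ g a) → ∀ a₀ → f a₀ < g a₀ →
    ∑ᵛ m f < ∑ᵛ m g
  ∑ᵛ-mono-< zero    f≤g []       f<g = f<g
  ∑ᵛ-mono-< (suc m) f≤g (i ∷ a₀) f<g =
    ∑-mono-< (λ j → ∑ᵛ-mono-≤ m (λ a → f≤g (j ∷ a))) i (∑ᵛ-mono-< m (λ a → f≤g (i ∷ a)) a₀ f<g)

  ∃ᵛ? : ∀ {p} m {Q : Pred (Vec (Fin s) m) p} → Decidable Q → Dec (∃ Q)
  ∃ᵛ? zero    Q? = Dec.map′ ([] ,_) (λ { ([] , q) → q }) (Q? [])
  ∃ᵛ? (suc m) Q? = Dec.map′ (λ { (i , a , q) → i ∷ a , q }) (λ { (i ∷ a , q) → i , a , q })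
                            (any? (λ i → ∃ᵛ? m (λ a → Q? (i ∷ a))))

module _ {o ℓ : Level} (F : FiniteField o ℓ) where

  open FiniteField F hiding (zero)
  open Codes F
  open import Algebra.Properties.Ring ring using (-1*x≈-x; +-cancelˡ; +-inverseʳ-unique; -‿involutive)
  import Relation.Binary.Reasoning.Setoid setoid as ≈-Reasoning
  open CoefficientSums q

  χ≉0 : Carrier → ℕ
  χ≉0 y = indicator (¬? (y ≟ 0#))

  χ≉0-cong : ∀ {x y} → x ≈ y → χ≉0 x ≡ χ≉0 y
  χ≉0-cong {x} {y} x≈y with x ≟ 0# | y ≟ 0#
  ... | yes _   | yes _   = ≡.refl
  ... | no _    | no _    = ≡.refl
  ... | yes x≈0 | no y≉0  = contradiction (trans (sym x≈y) x≈0) y≉0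
  ... | no x≉0  | yes y≈0 = contradiction (trans x≈y y≈0) x≉0

  χ≉0-≈0 : ∀ {y} → y ≈ 0# → χ≉0 y ≡ 0
  χ≉0-≈0 {y} y≈0 with y ≟ 0#
  ... | yes _   = ≡.refl
  ... | no y≉0  = contradiction y≈0 y≉0

  χ≉0≡0⇒≈0 : ∀ {y} → χ≉0 y ≡ 0 → y ≈ 0#
  χ≉0≡0⇒≈0 {y} χy≡0 with y ≟ 0#
  ... | yes y≈0 = y≈0
  ... | no _ with () ← χy≡0

  weight≡∑χ≉0 : ∀ {n} (v : Word n) → weight v ≡ ∑[ x < n ] χ≉0 (v x)
  weight≡∑χ≉0 v = length-filter-tabulate (λ x → ¬? (v x ≟ 0#)) id

  weight-zero : ∀ {n} {v : Word n} → v ≋ zeroW → weight v ≡ 0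
  weight-zero {n} {v} v≋0 =
    ≡.trans (weight≡∑χ≉0 v) (≡.trans (sum-cong-≗ (χ≉0-≈0 ∘ v≋0)) (sum-replicate-zero n))

  weight≡0⇒≋zero : ∀ {n} {v : Word n} → weight v ≡ 0 → v ≋ zeroW
  weight≡0⇒≋zero {v = v} wv≡0 x = χ≉0≡0⇒≈0 (n≤0⇒n≡0 χvx≤0)
    where
    χvx≤0 : χ≉0 (v x) ≤ 0
    χvx≤0 = ≡.subst (χ≉0 (v x) ≤_) (≡.trans (≡.sym (weight≡∑χ≉0 v)) wv≡0) (term≤∑ (χ≉0 ∘ v) x)

  nonzero⇒weight>0 : ∀ {n} {v : Word n} → isNonzero v → 0 < weight v
  nonzero⇒weight>0 v≉0 = n≢0⇒n>0 (v≉0 ∘ weight≡0⇒≋zero)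

  ≋zero? : ∀ {n} (v : Word n) → Dec (v ≋ zeroW)
  ≋zero? v = all? (λ x → v x ≟ 0#)

  weight-≤-of-constant : ∀ {n p} {C : Pred (Word n) p} → IsConstantWeight C →
    ∀ {v w} → C v → C w → isNonzero w → weight v ≤ weight w
  weight-≤-of-constant constant {v} {w} v∈C w∈C w≉0 with ≋zero? v
  ... | yes v≋0 = ≡.subst (_≤ weight w) (≡.sym (weight-zero v≋0)) z≤n
  ... | no v≉0  = ≤-reflexive (constant v∈C w∈C v≉0 w≉0)

  *-cancelʳ-≉0 : ∀ {c x y} → ¬ c ≈ 0# → x * c ≈ y * c → x ≈ y
  *-cancelʳ-≉0 {c} {x} {y} c≉0 xc≈yc with inverse c c≉0
  ... | c⁻¹ , cc⁻¹≈1 = begin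
    x              ≈⟨ sym (*-identityʳ x) ⟩
    x * 1#         ≈⟨ *-congˡ (sym cc⁻¹≈1) ⟩
    x * (c * c⁻¹)  ≈⟨ sym (*-assoc x c c⁻¹) ⟩
    x * c * c⁻¹    ≈⟨ *-congʳ xc≈yc ⟩
    y * c * c⁻¹    ≈⟨ *-assoc y c c⁻¹ ⟩
    y * (c * c⁻¹)  ≈⟨ *-congˡ cc⁻¹≈1 ⟩
    y * 1#         ≈⟨ *-identityʳ y ⟩
    y              ∎
    where open ≈-Reasoning

  affine-root : ∀ {c} → ¬ c ≈ 0# → ∀ b → ∃ λ x → b + x * c ≈ 0#
  affine-root {c} c≉0 b with inverse c c≉0
  ... | c⁻¹ , cc⁻¹≈1 = - b * c⁻¹ , (begin
    b + - b * c⁻¹ * c    ≈⟨ +-congˡ (*-assoc (- b) c⁻¹ c) ⟩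
    b + - b * (c⁻¹ * c)  ≈⟨ +-congˡ (*-congˡ (trans (*-comm c⁻¹ c) cc⁻¹≈1)) ⟩
    b + - b * 1#         ≈⟨ +-congˡ (*-identityʳ (- b)) ⟩
    b + - b              ≈⟨ -‿inverseʳ b ⟩
    0#                   ∎)
    where open ≈-Reasoning

  -- x ↦ b + x c has exactly one root, so it is nonzero at the other q − 1 points.
  affine-count : ∀ {c} → ¬ c ≈ 0# → ∀ b → 1 ℕ.+ ∑[ i < q ] χ≉0 (b + enum i * c) ≡ q
  affine-count {c} c≉0 b = begin
    1 ℕ.+ ∑[ i < q ] χ≉0 (b + enum i * c)
      ≡⟨ ≡.cong₂ ℕ._+_ (≡.sym unique-root) ≡.refl ⟩
    ∑[ i < q ] indicator (root? i) ℕ.+ ∑[ i < q ] indicator (¬? (root? i))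
      ≡⟨ ≡.sym (∑-distrib-+ (indicator ∘ root?) (indicator ∘ ¬? ∘ root?)) ⟩
    ∑[ i < q ] (indicator (root? i) ℕ.+ indicator (¬? (root? i)))
      ≡⟨ sum-cong-≗ (indicator+indicator-¬?≡1 ∘ root?) ⟩
    ∑[ i < q ] 1
      ≡⟨ ∑-const-1 q ⟩
    q ∎
    where
    open ≡.≡-Reasoning
    root? : ∀ i → Dec (b + enum i * c ≈ 0#)
    root? i = (b + enum i * c) ≟ 0#
    x₀ : Carrier
    x₀ = proj₁ (affine-root c≉0 b)
    i₀ : Fin q
    i₀ = proj₁ (enum-surjective x₀)
    enum-i₀≈x₀ : enum i₀ ≈ x₀
    enum-i₀≈x₀ = proj₂ (enum-surjective x₀) ≡.refl
    root-i₀ : b + enum i₀ * c ≈ 0#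
    root-i₀ = trans (+-congˡ (*-congʳ enum-i₀≈x₀)) (proj₂ (affine-root c≉0 b))
    only-root : ∀ {i} → b + enum i * c ≈ 0# → i ≡ i₀
    only-root root-i = enum-injective
      (*-cancelʳ-≉0 c≉0 (+-cancelˡ b _ _ (trans root-i (sym root-i₀))))
    unique-root : ∑[ i < q ] indicator (root? i) ≡ 1
    unique-root = ∑-indicator-unique root? root-i₀ only-root

  affine-count-shift : ∀ {c} → ¬ c ≈ 0# → ∀ b b' →
    ∑[ i < q ] χ≉0 (b + enum i * c) ≡ ∑[ i < q ] χ≉0 (b' + enum i * c)
  affine-count-shift c≉0 b b' =
    +-cancelˡ-≡ 1 _ _ (≡.trans (affine-count c≉0 b) (≡.sym (affine-count c≉0 b')))

  -- Coefficient vectors are vectors of indices into enum, so that we can sum over them.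
  lincomb : ∀ {m} → (Fin m → Carrier) → Vec (Fin q) m → Carrier
  lincomb c []      = 0#
  lincomb c (i ∷ a) = enum i * c zero + lincomb (c ∘ suc) a

  ∑-χ≉0-lincomb-shift : ∀ m (c : Fin m → Carrier) j → ¬ c j ≈ 0# → ∀ b b' →
    ∑ᵛ m (λ a → χ≉0 (b + lincomb c a)) ≡ ∑ᵛ m (λ a → χ≉0 (b' + lincomb c a))
  ∑-χ≉0-lincomb-shift (suc m) c zero c₀≉0 b b' =
    ≡.trans (regroup b) (≡.trans (∑ᵛ-cong m shift) (≡.sym (regroup b')))
    where
    regroup : ∀ b → ∑ᵛ (suc m) (λ a → χ≉0 (b + lincomb c a))
                  ≡ ∑ᵛ m (λ a → ∑[ i < q ] χ≉0 ((b + lincomb (c ∘ suc) a) + enum i * c zero))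
    regroup b = ≡.trans
      (sum-cong-≗ λ i → ∑ᵛ-cong m λ a → χ≉0-cong
        (trans (+-congˡ (+-comm (enum i * c zero) (lincomb (c ∘ suc) a)))
               (sym (+-assoc b (lincomb (c ∘ suc) a) (enum i * c zero)))))
      (≡.sym (∑ᵛ-∑-comm m λ a i → χ≉0 ((b + lincomb (c ∘ suc) a) + enum i * c zero)))
    shift : ∀ a → ∑[ i < q ] χ≉0 ((b + lincomb (c ∘ suc) a) + enum i * c zero)
                ≡ ∑[ i < q ] χ≉0 ((b' + lincomb (c ∘ suc) a) + enum i * c zero)
    shift a = affine-count-shift c₀≉0 _ _
  ∑-χ≉0-lincomb-shift (suc m) c (suc j) cⱼ≉0 b b' = sum-cong-≗ λ i →
    ≡.trans (∑ᵛ-cong m (χ≉0-cong ∘ reassoc b i))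
      (≡.trans (∑-χ≉0-lincomb-shift m (c ∘ suc) j cⱼ≉0 _ _)
        (≡.sym (∑ᵛ-cong m (χ≉0-cong ∘ reassoc b' i))))
    where
    reassoc : ∀ b i a → b + lincomb c (i ∷ a) ≈ (b + enum i * c zero) + lincomb (c ∘ suc) a
    reassoc b i a = sym (+-assoc b _ _)

  lincomb-zero : ∀ {m} (c : Fin m → Carrier) {i₀} → enum i₀ ≈ 0# → lincomb c (replicate m i₀) ≈ 0#
  lincomb-zero {zero}  c e≈0 = refl
  lincomb-zero {suc m} c e≈0 =
    trans (+-cong (trans (*-congʳ e≈0) (zeroˡ (c zero))) (lincomb-zero (c ∘ suc) e≈0)) (+-identityˡ 0#)

  combination : ∀ {m n} → (Fin m → Word n) → Vec (Fin q) m → Word n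
  combination ds a x = lincomb (λ j → ds j x) a

  combination-∈ : ∀ {m n p} {D : Pred (Word n) p} → IsSubspace D →
    ∀ {ds : Fin m → Word n} → (∀ j → D (ds j)) → ∀ a → D (combination ds a)
  combination-∈ D-sub ds∈D []      = IsSubspace.has-zero D-sub
  combination-∈ D-sub ds∈D (i ∷ a) = IsSubspace.closed-+ D-sub
    (IsSubspace.closed-· D-sub (enum i) (ds∈D zero)) (combination-∈ D-sub (ds∈D ∘ suc) a)

  ∑ᵛ-weight : ∀ m {n} (w : Vec (Fin q) m → Word n) →
    ∑ᵛ m (weight ∘ w) ≡ ∑[ x < n ] ∑ᵛ m (λ a → χ≉0 (w a x))
  ∑ᵛ-weight m w = ≡.trans (∑ᵛ-cong m (weight≡∑χ≉0 ∘ w)) (∑ᵛ-∑-comm m λ a x → χ≉0 (w a x))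

  module SupportArgument {n p} {C D : Pred (Word n) p}
    (C-sub : IsSubspace C) (C-constant : IsConstantWeight C)
    (D-sub : IsSubspace D) (D⊆C : D ⊆ C)
    {u : Word n} (u∈C : C u) (u-supported : ∀ x → ¬ u x ≈ 0# → Supp D x) where

    generator : ∀ x → Σ (Word n) λ d → D d × (¬ u x ≈ 0# → ¬ d x ≈ 0#)
    generator x with u x ≟ 0#
    ... | yes ux≈0 = zeroW , IsSubspace.has-zero D-sub , contradiction ux≈0
    ... | no ux≉0  = let (d , d∈D , dx≉0) = u-supported x ux≉0 in d , d∈D , λ _ → dx≉0

    φ : Vec (Fin q) n → Word n
    φ = combination (proj₁ ∘ generator)

    φ∈D : ∀ a → D (φ a)
    φ∈D = combination-∈ D-sub (proj₁ ∘ proj₂ ∘ generator)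

    ψ : Vec (Fin q) n → Word n
    ψ a = ((- 1#) · u) ⊕ φ a

    ψ∈C : ∀ a → C (ψ a)
    ψ∈C a = IsSubspace.closed-+ C-sub (IsSubspace.closed-· C-sub (- 1#) u∈C) (D⊆C (φ∈D a))

    count-coordinate : ∀ x → ∑ᵛ n (λ a → χ≉0 (ψ a x)) ≡ ∑ᵛ n (λ a → χ≉0 (φ a x))
    count-coordinate x with u x ≟ 0#
    ... | yes ux≈0 = ∑ᵛ-cong n λ a →
      χ≉0-cong (trans (+-congʳ (trans (*-congˡ ux≈0) (zeroʳ (- 1#)))) (+-identityˡ (φ a x)))
    ... | no ux≉0 = ≡.trans
      (∑-χ≉0-lincomb-shift n (λ j → proj₁ (generator j) x) x (proj₂ (proj₂ (generator x)) ux≉0) _ 0#)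
      (∑ᵛ-cong n λ a → χ≉0-cong (+-identityˡ (φ a x)))

    ∑weight-ψ≡∑weight-φ : ∑ᵛ n (weight ∘ ψ) ≡ ∑ᵛ n (weight ∘ φ)
    ∑weight-ψ≡∑weight-φ =
      ≡.trans (∑ᵛ-weight n ψ) (≡.trans (sum-cong-≗ count-coordinate) (≡.sym (∑ᵛ-weight n φ)))

    ψ-vanishes : ∃ λ a → ψ a ≋ zeroW
    ψ-vanishes with ∃ᵛ? n (≋zero? ∘ ψ)
    ... | yes found = found
    ... | no none   = contradiction ∑weight-ψ≡∑weight-φ (≢-sym (<⇒≢ weight-φ<weight-ψ))
      where
      ψ≉0 : ∀ a → isNonzero (ψ a)
      ψ≉0 a ψa≋0 = none (a , ψa≋0)
      i₀ : Fin q
      i₀ = proj₁ (enum-surjective 0#)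
      a₀ : Vec (Fin q) n
      a₀ = replicate n i₀
      φa₀≋0 : φ a₀ ≋ zeroW
      φa₀≋0 x = lincomb-zero (λ j → proj₁ (generator j) x) (proj₂ (enum-surjective 0#) ≡.refl)
      weight-φ<weight-ψ : ∑ᵛ n (weight ∘ φ) < ∑ᵛ n (weight ∘ ψ)
      weight-φ<weight-ψ = ∑ᵛ-mono-< n
        (λ a → weight-≤-of-constant C-constant (D⊆C (φ∈D a)) (ψ∈C a) (ψ≉0 a)) a₀
        (≡.subst (_< weight (ψ a₀)) (≡.sym (weight-zero φa₀≋0)) (nonzero⇒weight>0 (ψ≉0 a₀)))

    ψ≋0⇒φ≋u : ∀ a → ψ a ≋ zeroW → φ a ≋ u
    ψ≋0⇒φ≋u a ψa≋0 x = trans (+-inverseʳ-unique (- 1# * u x) (φ a x) (ψa≋0 x))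
      (trans (-‿cong (-1*x≈-x (u x))) (-‿involutive (u x)))

    u∈D : D u
    u∈D = let (a , ψa≋0) = ψ-vanishes in IsSubspace.respects D-sub (ψ≋0⇒φ≋u a ψa≋0) (φ∈D a)

  ⊆Supp⇒∈ : ∀ {n p} {C D : Pred (Word n) p} → IsSubspace C → IsConstantWeight C →
    IsSubspace D → D ⊆ C → ∀ {u} → C u → (∀ x → ¬ u x ≈ 0# → Supp D x) → D u
  ⊆Supp⇒∈ C-sub C-constant D-sub D⊆C u∈C u-supported =
    SupportArgument.u∈D C-sub C-constant D-sub D⊆C u∈C u-supported

proposition2 : ∀ {c ℓ p : Level} (F : FiniteField c ℓ) (n : ℕ)
    → let open Codes F in
    (C : Pred (Word n) p) → IsSubspace C → IsConstantWeight C
    → (D₁ D₂ : Pred (Word n) p) → IsSubcode C D₁ → IsSubcode C D₂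
    → Supp D₁ ≐ Supp D₂
    → D₁ ≐ D₂
proposition2 F n C C-sub C-constant D₁ D₂ (D₁-sub , D₁⊆C) (D₂-sub , D₂⊆C) (S₁⊆S₂ , S₂⊆S₁) =
  (λ u∈D₁ → ⊆Supp⇒∈ F C-sub C-constant D₂-sub D₂⊆C (D₁⊆C u∈D₁) (λ x ux≉0 → S₁⊆S₂ (_ , u∈D₁ , ux≉0))) ,
  (λ u∈D₂ → ⊆Supp⇒∈ F C-sub C-constant D₁-sub D₁⊆C (D₂⊆C u∈D₂) (λ x ux≉0 → S₂⊆S₁ (_ , u∈D₂ , ux≉0)))
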